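{- (1) For all $\lambda$-terms $t,u$: if $t\to_\beta^* u$ then there is $s$ with $t\to_{\ell\ell}^* s\to_{\neg\ell\ell}^* u$. (2) $\to_{\ell\ell}$ is a normalizing reduction for $\to_\beta$: $\to_{\ell\ell}\subseteq\to_\beta$, $\to_{\ell\ell}$ and $\to_\beta$ have the same normal forms, and every term that is weakly $\to_\beta$-normalizing is strongly $\to_{\ell\ell}$-normalizing.
   Context: $\lambda$-terms: $t,s::=x\mid\lambda x.t\mid ts$ (up to $\alpha$-equivalence); $t\{x:=s\}$ capture-avoiding substitution. $\beta$-reduction of level $k\in\mathbb N$, $\to_{\beta:k}$: $(\lambda x.t)s\to_{\beta:0}t\{x:=s\}$; if $t\to_{\beta:k}t'$ then $\lambda x.t\to_{\beta:k}\lambda x.t'$, $ts\to_{\beta:k}t's$, and $st\to_{\beta:k+1}st'$. Then $\to_\beta=\bigcup_k\to_{\beta:k}$. The least level $\mathrm{deg}(t)\in\mathbb N\cup\{\infty\}$: $\mathrm{deg}(x)=\infty$, $\mathrm{deg}(\lambda x.t)=\mathrm{deg}(t)$, $\mathrm{deg}(ts)=0$ if $t$ is an abstraction and $\min\{\mathrm{deg}(t),\mathrm{deg}(s)+1\}$ otherwise (with $\infty+1=\infty$). Least-level reduction: $t\to_{\ell\ell}s$ iff $t\to_{\beta:k}s$ with $k=\mathrm{deg}(t)$; $t\to_{\neg\ell\ell}s$ iff $t\to_{\beta:k}s$ with $\mathrm{deg}(t)<k\in\mathbb N$. A term is $\to$-normal if it has no $\to$-step; weakly $\to$-normalizing if it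 reduces by $\to^*$ to a $\to$-normal term; strongly $\to$-normalizing if there is no infinite $\to$-sequence from it. -}

module Defs where

open import Data.Nat using (ℕ; zero; suc; _<_; _≤_; _⊔_) renaming (_⊓_ to min)
open import Data.Nat.Properties using (_<?_)
open import Data.Empty using (⊥)
open import Relation.Binary.PropositionalEquality using (_≡_)
open import Data.Product using (Σ; ∃; _×_; _,_)
open import Relation.Nullary using (¬_; yes; no)
open import Relation.Binary.Construct.Closure.ReflexiveTransitive using (Star)
open import Induction.WellFounded using (Acc)

-- λ-terms up to α-equivalence, represented with de Bruijn indices.
data Term : Set where
  var : ℕ → Term
  lam : Term → Term
  app : Term → Term → Term

shift : ℕ → Term → Term
shift c (var x) with x <? c
... | yes _ = var x
... | no  _ = var (suc x)
shift c (lam t) = lam (shift (suc c) t)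
shift c (app t s) = app (shift c t) (shift c s)

-- capture-avoiding substitution t{x:=s} of s for index x, removing x
-- (indices above x are decremented).
subst : ℕ → Term → Term → Term
subst x (var y) s with y <? x
... | yes _ = var y
subst x (var y) s | no _ with x <? y
subst x (var (suc y)) s | no _ | yes _ = var y
subst x (var zero) s    | no _ | yes ()
... | no _ = s
subst x (lam t) s = lam (subst (suc x) t (shift 0 s))
subst x (app t u) s = app (subst x t s) (subst x u s)

_[_] : Term → Term → Term
t [ s ] = subst 0 t s

data _→β[_]_ : Term → ℕ → Term → Set where
  beta  : ∀ {t s} → app (lam t) s →β[ 0 ] (t [ s ])
  ξlam  : ∀ {t t' k} → t →β[ k ] t' → lam t →β[ k ] lam t'
  ξappl : ∀ {t t' s k} → t →β[ k ] t' → app t s →β[ k ] app t' s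
  ξappr : ∀ {t t' s k} → t →β[ k ] t' → app s t →β[ suc k ] app s t'

_→β_ : Term → Term → Set
t →β u = ∃ λ k → t →β[ k ] u

data ℕ∞ : Set where
  fin : ℕ → ℕ∞
  ∞   : ℕ∞

suc∞ : ℕ∞ → ℕ∞
suc∞ (fin n) = fin (suc n)
suc∞ ∞ = ∞

min∞ : ℕ∞ → ℕ∞ → ℕ∞
min∞ (fin m) (fin n) = fin (min m n)
min∞ (fin m) ∞ = fin m
min∞ ∞ b = b


deg : Term → ℕ∞
deg (var x) = ∞
deg (lam t) = deg t
deg (app (lam t) s) = fin 0
deg (app (var x) s) = min∞ (deg (var x)) (suc∞ (deg s))
deg (app (app t u) s) = min∞ (deg (app t u)) (suc∞ (deg s))

_<∞_ : ℕ∞ → ℕ → Set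
fin m <∞ k = m < k
∞ <∞ k = ⊥

_→ll_ : Term → Term → Set
t →ll u = ∃ λ k → (deg t ≡ fin k) × (t →β[ k ] u)


_→nll_ : Term → Term → Set
t →nll u = ∃ λ k → (deg t <∞ k) × (t →β[ k ] u)

_* : (Term → Term → Set) → Term → Term → Set
R * = Star R

Normal : (Term → Term → Set) → Term → Set
Normal R t = ∀ u → ¬ R t u

WeaklyNormalizing : (Term → Term → Set) → Term → Set
WeaklyNormalizing R t = ∃ λ u → (R *) t u × Normal R u

-- strong normalization: t is accessible for the converse relation,
-- i.e. no infinite R-sequence starts from t (constructive formulation).
StronglyNormalizing : (Term → Term → Set) → Term → Set
StronglyNormalizing R t = Acc (λ u v → R v u) t

module Submission where

-- A β-step contracts a redex either at the least level deg t (ℓℓ) or strictly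
-- above it (¬ℓℓ), and ¬ℓℓ-steps leave the least level unchanged.  To postpone
-- ¬ℓℓ-steps we use a parallel reduction Par k contracting redexes of level
-- ≥ k only, with a weight bounding the length of its development: a Par k-step
-- followed by a step of level < k merges into a Par 0-step, and a Par 0-step
-- splits into ℓℓ-steps (each lowering the weight) followed by a parallel step
-- strictly above the least level.
-- Normal forms agree since a term of finite degree d has a redex at level d.
-- Finally →ℓℓ has the diamond property, so along any ℓℓ-path the distance to
-- a normal form decreases ("random descent"); with (1), whose ¬ℓℓ-part is
-- empty when the target is β-normal, WN for β gives SN for ℓℓ.

open import Defs
open import Data.Nat using (ℕ; zero; suc; _<_; _≤_; z≤n; s≤s; pred; _+_; _*_)
open import Data.Nat.Properties
open import Data.Nat.Solver using (module +-*-Solver)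
open import Data.Empty using (⊥-elim)
open import Data.Product using (_×_; ∃; Σ; _,_; proj₂; map; map₂)
open import Data.Sum using (_⊎_; inj₁; inj₂; [_,_]′)
open import Relation.Nullary using (¬_; yes; no)
open import Relation.Binary.Definitions using (tri<; tri≈; tri>)
open import Relation.Binary.PropositionalEquality
  using (_≡_; _≢_; refl; sym; trans; cong; cong₂; module ≡-Reasoning)
  renaming (subst to transport)
open import Relation.Binary.Construct.Closure.ReflexiveTransitive
  using (Star; ε; _◅_; _◅◅_; gmap)
open import Induction.WellFounded using (Acc; acc)
open import Function.Bundles using (_⇔_; mk⇔)

-- De Bruijn substitution algebra

shift-var-below : ∀ {x c} → x < c → shift c (var x) ≡ var x
shift-var-below {x} {c} x<c with x <? c
... | yes _ = refl
... | no x≮c = ⊥-elim (x≮c x<c)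

shift-var-above : ∀ {x c} → c ≤ x → shift c (var x) ≡ var (suc x)
shift-var-above {x} {c} c≤x with x <? c
... | yes x<c = ⊥-elim (<⇒≱ x<c c≤x)
... | no _ = refl

subst-var-below : ∀ {x y s} → y < x → subst x (var y) s ≡ var y
subst-var-below {x} {y} y<x with y <? x
... | yes _ = refl
... | no y≮x = ⊥-elim (y≮x y<x)

subst-var-here : ∀ {x s} → subst x (var x) s ≡ s
subst-var-here {zero} = refl
subst-var-here {suc x} with suc x <? suc x
... | yes x<x = ⊥-elim (<-irrefl refl x<x)
... | no _ with suc x <? suc x
... | yes x<x = ⊥-elim (<-irrefl refl x<x)
... | no _ = refl

subst-var-above : ∀ {x y s} → x < y → subst x (var y) s ≡ var (pred y)
subst-var-above {x} {suc y} x<y with suc y <? x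
... | yes y<x = ⊥-elim (<-asym x<y y<x)
... | no _ with x <? suc y
... | yes _ = refl
... | no x≮y = ⊥-elim (x≮y x<y)

shift-shift : ∀ d c t → d ≤ c →
  shift (suc c) (shift d t) ≡ shift d (shift c t)
shift-shift d c (var x) d≤c with <-≤-connex x d
... | inj₁ x<d
  rewrite shift-var-below x<d | shift-var-below (<-≤-trans x<d (m≤n⇒m≤1+n d≤c))
        | shift-var-below (<-≤-trans x<d d≤c) | shift-var-below x<d = refl
... | inj₂ d≤x with <-≤-connex x c
...   | inj₁ x<c
  rewrite shift-var-above d≤x | shift-var-below {suc x} {suc c} (s≤s x<c)
        | shift-var-below x<c | shift-var-above d≤x = refl
...   | inj₂ c≤x
  rewrite shift-var-above d≤x | shift-var-above {suc x} {suc c} (s≤s c≤x)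
        | shift-var-above c≤x | shift-var-above (m≤n⇒m≤1+n d≤x) = refl
shift-shift d c (lam t) d≤c = cong lam (shift-shift (suc d) (suc c) t (s≤s d≤c))
shift-shift d c (app t u) d≤c = cong₂ app (shift-shift d c t d≤c) (shift-shift d c u d≤c)

shift-subst-above : ∀ c x t s → x ≤ c →
  shift c (subst x t s) ≡ subst x (shift (suc c) t) (shift c s)
shift-subst-above c x (var y) s x≤c with <-cmp y x
... | tri< y<x _ _
  rewrite subst-var-below {s = s} y<x | shift-var-below (<-≤-trans y<x x≤c)
        | shift-var-below (<-≤-trans y<x (m≤n⇒m≤1+n x≤c))
        | subst-var-below {s = shift c s} y<x = refl
... | tri≈ _ refl _
  rewrite subst-var-here {x} {s} | shift-var-below {x} {suc c} (s≤s x≤c)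
        | subst-var-here {x} {shift c s} = refl
shift-subst-above c x (var (suc y)) s x≤c | tri> _ _ x<y
  rewrite subst-var-above {s = s} x<y with <-≤-connex y c
... | inj₁ y<c
  rewrite shift-var-below y<c | shift-var-below {suc y} {suc c} (s≤s y<c)
        | subst-var-above {s = shift c s} x<y = refl
... | inj₂ c≤y
  rewrite shift-var-above c≤y | shift-var-above {suc y} {suc c} (s≤s c≤y)
        | subst-var-above {x} {suc (suc y)} {shift c s} (m<n⇒m<1+n x<y) = refl
shift-subst-above c x (lam t) s x≤c = cong lam (begin
  shift (suc c) (subst (suc x) t (shift 0 s))
    ≡⟨ shift-subst-above (suc c) (suc x) t (shift 0 s) (s≤s x≤c) ⟩
  subst (suc x) (shift (suc (suc c)) t) (shift (suc c) (shift 0 s))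
    ≡⟨ cong (subst (suc x) (shift (suc (suc c)) t)) (shift-shift 0 c s z≤n) ⟩
  subst (suc x) (shift (suc (suc c)) t) (shift 0 (shift c s)) ∎)
  where open ≡-Reasoning
shift-subst-above c x (app t u) s x≤c =
  cong₂ app (shift-subst-above c x t s x≤c) (shift-subst-above c x u s x≤c)

shift-subst-below : ∀ c x t s → c ≤ x →
  shift c (subst x t s) ≡ subst (suc x) (shift c t) (shift c s)
shift-subst-below c x (var y) s c≤x with <-cmp y x
... | tri< y<x _ _ with <-≤-connex y c
...   | inj₁ y<c
  rewrite subst-var-below {s = s} y<x | shift-var-below y<c
        | subst-var-below {s = shift c s} (m<n⇒m<1+n y<x) = refl
...   | inj₂ c≤y
  rewrite subst-var-below {s = s} y<x | shift-var-above c≤y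
        | subst-var-below {suc x} {suc y} {shift c s} (s≤s y<x) = refl
shift-subst-below c x (var y) s c≤x | tri≈ _ refl _
  rewrite subst-var-here {x} {s} | shift-var-above c≤x
        | subst-var-here {suc x} {shift c s} = refl
shift-subst-below c x (var (suc y)) s c≤x | tri> _ _ x<y
  rewrite subst-var-above {s = s} x<y | shift-var-above (≤-trans c≤x (≤-pred x<y))
        | shift-var-above {suc y} (m≤n⇒m≤1+n (≤-trans c≤x (≤-pred x<y)))
        | subst-var-above {suc x} {suc (suc y)} {shift c s} (s≤s x<y) = refl
shift-subst-below c x (lam t) s c≤x = cong lam (begin
  shift (suc c) (subst (suc x) t (shift 0 s))
    ≡⟨ shift-subst-below (suc c) (suc x) t (shift 0 s) (s≤s c≤x) ⟩
  subst (suc (suc x)) (shift (suc c) t) (shift (suc c) (shift 0 s))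
    ≡⟨ cong (subst (suc (suc x)) (shift (suc c) t)) (shift-shift 0 c s z≤n) ⟩
  subst (suc (suc x)) (shift (suc c) t) (shift 0 (shift c s)) ∎)
  where open ≡-Reasoning
shift-subst-below c x (app t u) s c≤x =
  cong₂ app (shift-subst-below c x t s c≤x) (shift-subst-below c x u s c≤x)

subst-shift-cancel : ∀ x t s → subst x (shift x t) s ≡ t
subst-shift-cancel x (var y) s with <-≤-connex y x
... | inj₁ y<x rewrite shift-var-below y<x | subst-var-below {s = s} y<x = refl
... | inj₂ x≤y rewrite shift-var-above x≤y | subst-var-above {s = s} (s≤s x≤y) = refl
subst-shift-cancel x (lam t) s = cong lam (subst-shift-cancel (suc x) t (shift 0 s))
subst-shift-cancel x (app t u) s =
  cong₂ app (subst-shift-cancel x t s) (subst-shift-cancel x u s)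

subst-subst : ∀ x y t u s → y ≤ x →
  subst x (subst y t u) s ≡ subst y (subst (suc x) t (shift y s)) (subst x u s)
subst-subst x y (var z) u s y≤x with <-cmp z y
... | tri< z<y _ _
  rewrite subst-var-below {s = u} z<y | subst-var-below {s = s} (<-≤-trans z<y y≤x)
        | subst-var-below {s = shift y s} (<-≤-trans z<y (m≤n⇒m≤1+n y≤x))
        | subst-var-below {s = subst x u s} z<y = refl
... | tri≈ _ refl _
  rewrite subst-var-here {y} {u} | subst-var-below {suc x} {y} {shift y s} (s≤s y≤x)
        | subst-var-here {y} {subst x u s} = refl
subst-subst x y (var (suc z)) u s y≤x | tri> _ _ y<z
  rewrite subst-var-above {s = u} y<z with <-cmp z x
... | tri< z<x _ _
  rewrite subst-var-below {s = s} z<x | subst-var-below {suc x} {suc z} {shift y s} (s≤s z<x)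
        | subst-var-above {s = subst x u s} y<z = refl
... | tri≈ _ refl _
  rewrite subst-var-here {z} {s} | subst-var-here {suc z} {shift y s}
        | subst-shift-cancel y s (subst z u s) = refl
subst-subst x y (var (suc (suc z))) u s y≤x | tri> _ _ y<z | tri> _ _ x<z
  rewrite subst-var-above {s = s} x<z | subst-var-above {suc x} {suc (suc z)} {shift y s} (s≤s x<z)
        | subst-var-above {y} {suc z} {subst x u s} (≤-<-trans y≤x x<z) = refl
subst-subst x y (lam t) u s y≤x = cong lam (begin
  subst (suc x) (subst (suc y) t (shift 0 u)) (shift 0 s)
    ≡⟨ subst-subst (suc x) (suc y) t (shift 0 u) (shift 0 s) (s≤s y≤x) ⟩
  subst (suc y) (subst (suc (suc x)) t (shift (suc y) (shift 0 s)))
                (subst (suc x) (shift 0 u) (shift 0 s))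
    ≡⟨ cong₂ (λ a b → subst (suc y) (subst (suc (suc x)) t a) b)
             (shift-shift 0 y s z≤n) (sym (shift-subst-below 0 x u s z≤n)) ⟩
  subst (suc y) (subst (suc (suc x)) t (shift 0 (shift y s))) (shift 0 (subst x u s)) ∎)
  where open ≡-Reasoning
subst-subst x y (app t t') u s y≤x =
  cong₂ app (subst-subst x y t u s y≤x) (subst-subst x y t' u s y≤x)

data _≤∞_ : ℕ∞ → ℕ∞ → Set where
  fin≤fin : ∀ {m n} → m ≤ n → fin m ≤∞ fin n
  ≤∞-top  : ∀ {a} → a ≤∞ ∞

0≤∞ : ∀ a → fin 0 ≤∞ a
0≤∞ (fin n) = fin≤fin z≤n
0≤∞ ∞ = ≤∞-top

≤∞-antisym : ∀ {a d} → fin d ≤∞ a → a ≤∞ fin d → a ≡ fin d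
≤∞-antisym (fin≤fin p) (fin≤fin q) = cong fin (≤-antisym q p)

≡⇒fin≤ : ∀ {a d} → a ≡ fin d → fin d ≤∞ a
≡⇒fin≤ refl = fin≤fin ≤-refl

≡⇒≤fin : ∀ {a d} → a ≡ fin d → a ≤∞ fin d
≡⇒≤fin refl = fin≤fin ≤-refl

≤min∞⇒≤ˡ : ∀ {c a b} → c ≤∞ min∞ a b → c ≤∞ a
≤min∞⇒≤ˡ {a = fin m} {fin n} (fin≤fin p) = fin≤fin (≤-trans p (m⊓n≤m m n))
≤min∞⇒≤ˡ {a = fin m} {∞} p = p
≤min∞⇒≤ˡ {a = ∞} p = ≤∞-top

≤min∞⇒≤ʳ : ∀ {c a b} → c ≤∞ min∞ a b → c ≤∞ b
≤min∞⇒≤ʳ {a = fin m} {fin n} (fin≤fin p) = fin≤fin (≤-trans p (m⊓n≤n m n))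
≤min∞⇒≤ʳ {a = fin m} {∞} p = ≤∞-top
≤min∞⇒≤ʳ {a = ∞} p = p

≤min∞ : ∀ {c a b} → c ≤∞ a → c ≤∞ b → c ≤∞ min∞ a b
≤min∞ (fin≤fin p) (fin≤fin q) = fin≤fin (⊓-glb p q)
≤min∞ {a = fin m} {∞} p q = p
≤min∞ {a = ∞} p q = q

min∞≤⇒⊎ : ∀ {a b d} → min∞ a b ≤∞ fin d → a ≤∞ fin d ⊎ b ≤∞ fin d
min∞≤⇒⊎ {fin m} {fin n} (fin≤fin p) with ⊓-sel m n
... | inj₁ e = inj₁ (fin≤fin (transport (_≤ _) e p))
... | inj₂ e = inj₂ (fin≤fin (transport (_≤ _) e p))
min∞≤⇒⊎ {fin m} {∞} p = inj₁ p
min∞≤⇒⊎ {∞} p = inj₂ p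

min∞-≤ˡ : ∀ {a b d} → a ≤∞ fin d → min∞ a b ≤∞ fin d
min∞-≤ˡ {fin m} {fin n} (fin≤fin p) = fin≤fin (m≤n⇒m⊓o≤n n p)
min∞-≤ˡ {fin m} {∞} p = p

min∞-≤ʳ : ∀ {a b d} → b ≤∞ fin d → min∞ a b ≤∞ fin d
min∞-≤ʳ {fin m} {fin n} (fin≤fin p) = fin≤fin (m≤n⇒o⊓m≤n m p)
min∞-≤ʳ {∞} p = p

min∞-sel : ∀ {a b d} → min∞ a b ≡ fin d → a ≡ fin d ⊎ b ≡ fin d
min∞-sel {fin m} {fin n} eq with ⊓-sel m n
... | inj₁ e = inj₁ (trans (cong fin (sym e)) eq)
... | inj₂ e = inj₂ (trans (cong fin (sym e)) eq)
min∞-sel {fin m} {∞} eq = inj₁ eq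
min∞-sel {∞} eq = inj₂ eq

suc∞-mono-≤fin : ∀ {a d} → a ≤∞ fin d → suc∞ a ≤∞ fin (suc d)
suc∞-mono-≤fin (fin≤fin p) = fin≤fin (s≤s p)

suc∞-cancel-≤fin : ∀ {a d} → suc∞ a ≤∞ fin (suc d) → a ≤∞ fin d
suc∞-cancel-≤fin {fin m} (fin≤fin (s≤s p)) = fin≤fin p

suc∞≰0 : ∀ {a} → ¬ (suc∞ a ≤∞ fin 0)
suc∞≰0 {fin m} (fin≤fin ())

suc∞-mono-fin≤ : ∀ {a j} → fin j ≤∞ a → fin (suc j) ≤∞ suc∞ a
suc∞-mono-fin≤ (fin≤fin p) = fin≤fin (s≤s p)
suc∞-mono-fin≤ ≤∞-top = ≤∞-top

suc∞-cancel-fin≤ : ∀ {a j} → fin (suc j) ≤∞ suc∞ a → fin j ≤∞ a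
suc∞-cancel-fin≤ {fin m} (fin≤fin (s≤s p)) = fin≤fin p
suc∞-cancel-fin≤ {∞} p = ≤∞-top

suc∞≡fin : ∀ {a d} → suc∞ a ≡ fin d → ∃ λ d' → d ≡ suc d' × a ≡ fin d'
suc∞≡fin {fin m} refl = m , refl , refl

<∞⇒fin : ∀ {a k} → a <∞ k → ∃ λ d → a ≡ fin d × d < k
<∞⇒fin {fin d} d<k = d , refl , d<k

-- The least level under reduction.

-- a step of level k witnesses a redex at level k, so deg t ≤ k
deg-≤-level : ∀ {t u k} → t →β[ k ] u → deg t ≤∞ fin k
deg-≤-level beta = fin≤fin z≤n
deg-≤-level (ξlam st) = deg-≤-level st
deg-≤-level (ξappl {t = lam _} st) = fin≤fin z≤n
deg-≤-level (ξappl {t = app _ _} st) = min∞-≤ˡ (deg-≤-level st)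
deg-≤-level (ξappr {s = lam _} st) = fin≤fin z≤n
deg-≤-level (ξappr {s = var _} st) = suc∞-mono-≤fin (deg-≤-level st)
deg-≤-level (ξappr {s = app _ _} st) = min∞-≤ʳ (suc∞-mono-≤fin (deg-≤-level st))

deg-lower-bound-stable : ∀ j {t u k} → t →β[ k ] u → j ≤ k →
  fin j ≤∞ deg t → fin j ≤∞ deg u
deg-lower-bound-stable zero _ _ _ = 0≤∞ _
deg-lower-bound-stable (suc j) beta () _
deg-lower-bound-stable (suc j) (ξlam st) j≤k lb = deg-lower-bound-stable (suc j) st j≤k lb
deg-lower-bound-stable (suc j) (ξappl (ξlam st)) j≤k (fin≤fin ())
deg-lower-bound-stable (suc j) (ξappl beta) () _
deg-lower-bound-stable (suc j) (ξappl st@(ξappl _)) j≤k lb =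
  ≤min∞ (deg-lower-bound-stable (suc j) st j≤k (≤min∞⇒≤ˡ lb)) (≤min∞⇒≤ʳ lb)
deg-lower-bound-stable (suc j) (ξappl st@(ξappr _)) j≤k lb =
  ≤min∞ (deg-lower-bound-stable (suc j) st j≤k (≤min∞⇒≤ˡ lb)) (≤min∞⇒≤ʳ lb)
deg-lower-bound-stable (suc j) (ξappr {s = lam _} st) j≤k (fin≤fin ())
deg-lower-bound-stable (suc j) (ξappr {s = var _} st) (s≤s j≤k) lb =
  suc∞-mono-fin≤ (deg-lower-bound-stable j st j≤k (suc∞-cancel-fin≤ lb))
deg-lower-bound-stable (suc j) (ξappr {s = app _ _} st) (s≤s j≤k) lb =
  ≤min∞ (≤min∞⇒≤ˡ lb)
        (suc∞-mono-fin≤ (deg-lower-bound-stable j st j≤k (suc∞-cancel-fin≤ (≤min∞⇒≤ʳ lb))))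

deg-upper-bound-stable : ∀ {t u k d} → t →β[ k ] u → deg t ≤∞ fin d → d < k →
  deg u ≤∞ fin d
deg-upper-bound-stable beta _ ()
deg-upper-bound-stable (ξlam st) ub d<k = deg-upper-bound-stable st ub d<k
deg-upper-bound-stable (ξappl (ξlam _)) _ _ = fin≤fin z≤n
deg-upper-bound-stable (ξappl beta) _ ()
deg-upper-bound-stable (ξappl {t = t} {t' = t'} {s = r} st@(ξappl _)) ub d<k =
  [ (λ a → min∞-≤ˡ (deg-upper-bound-stable st a d<k)) , min∞-≤ʳ {deg t'} ]′
    (min∞≤⇒⊎ {deg t} {suc∞ (deg r)} ub)
deg-upper-bound-stable (ξappl {t = t} {t' = t'} {s = r} st@(ξappr _)) ub d<k =
  [ (λ a → min∞-≤ˡ (deg-upper-bound-stable st a d<k)) , min∞-≤ʳ {deg t'} ]′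
    (min∞≤⇒⊎ {deg t} {suc∞ (deg r)} ub)
deg-upper-bound-stable (ξappr {s = lam _} _) _ _ = fin≤fin z≤n
deg-upper-bound-stable {d = zero} (ξappr {s = var _} st) ub _ = ⊥-elim (suc∞≰0 ub)
deg-upper-bound-stable {d = suc d} (ξappr {s = var _} st) ub (s≤s d<k) =
  suc∞-mono-≤fin (deg-upper-bound-stable st (suc∞-cancel-≤fin ub) d<k)
deg-upper-bound-stable {d = zero} (ξappr {t = t} {s = app a b} st) ub _ =
  [ min∞-≤ˡ , (λ b≤0 → ⊥-elim (suc∞≰0 b≤0)) ]′ (min∞≤⇒⊎ {deg (app a b)} {suc∞ (deg t)} ub)
deg-upper-bound-stable {d = suc d} (ξappr {t = t} {s = app a b} st) ub (s≤s d<k) =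
  [ min∞-≤ˡ
  , (λ b≤d → min∞-≤ʳ {deg (app a b)}
               (suc∞-mono-≤fin (deg-upper-bound-stable st (suc∞-cancel-≤fin b≤d) d<k))) ]′
    (min∞≤⇒⊎ {deg (app a b)} {suc∞ (deg t)} ub)

deg-stable-above : ∀ {t u k d} → t →β[ k ] u → deg t ≡ fin d → d < k → deg u ≡ fin d
deg-stable-above {d = d} st eq d<k =
  ≤∞-antisym (deg-lower-bound-stable d st (<⇒≤ d<k) (≡⇒fin≤ eq))
             (deg-upper-bound-stable st (≡⇒≤fin eq) d<k)

redex-in-argument : ∀ f {s d} → (∀ d' → deg s ≡ fin d' → ∃ λ u → s →β[ d' ] u) →
  suc∞ (deg s) ≡ fin d → ∃ λ u → app f s →β[ d ] u
redex-in-argument f {s} redex-in-s eq with suc∞≡fin {deg s} eq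
... | d' , refl , e = map (app f) ξappr (redex-in-s d' e)

redex-at-deg : ∀ t d → deg t ≡ fin d → ∃ λ u → t →β[ d ] u
redex-at-deg (var x) d ()
redex-at-deg (lam t) d eq = map lam ξlam (redex-at-deg t d eq)
redex-at-deg (app (lam t) s) .0 refl = _ , beta
redex-at-deg (app (var x) s) d eq = redex-in-argument (var x) (redex-at-deg s) eq
redex-at-deg (app (app a b) s) d eq =
  [ (λ e → map (λ u → app u s) ξappl (redex-at-deg (app a b) d e))
  , redex-in-argument (app a b) (redex-at-deg s) ]′ (min∞-sel {deg (app a b)} eq)

-- Counting free occurrences of an index: this is how often a substituted
-- argument gets duplicated, which the weight of parallel reduction must track.

occ-var : ℕ → ℕ → ℕ
occ-var zero zero = 1
occ-var zero (suc _) = 0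
occ-var (suc _) zero = 0
occ-var (suc x) (suc y) = occ-var x y

occ-var-self : ∀ x → occ-var x x ≡ 1
occ-var-self zero = refl
occ-var-self (suc x) = occ-var-self x

occ-var-other : ∀ {x y} → x ≢ y → occ-var x y ≡ 0
occ-var-other {zero} {zero} x≢y = ⊥-elim (x≢y refl)
occ-var-other {zero} {suc y} x≢y = refl
occ-var-other {suc x} {zero} x≢y = refl
occ-var-other {suc x} {suc y} x≢y = occ-var-other (λ e → x≢y (cong suc e))

occ : ℕ → Term → ℕ
occ x (var y) = occ-var x y
occ x (lam t) = occ (suc x) t
occ x (app t s) = occ x t + occ x s

occ-shift-below : ∀ y c t → y < c → occ y (shift c t) ≡ occ y t
occ-shift-below y c (var z) y<c with <-≤-connex z c
... | inj₁ z<c rewrite shift-var-below z<c = refl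
... | inj₂ c≤z
  rewrite shift-var-above c≤z | occ-var-other {y} {suc z} (<⇒≢ (<-≤-trans y<c (m≤n⇒m≤1+n c≤z)))
        | occ-var-other {y} {z} (<⇒≢ (<-≤-trans y<c c≤z)) = refl
occ-shift-below y c (lam t) y<c = occ-shift-below (suc y) (suc c) t (s≤s y<c)
occ-shift-below y c (app t u) y<c = cong₂ _+_ (occ-shift-below y c t y<c) (occ-shift-below y c u y<c)

occ-shift-cutoff : ∀ c t → occ c (shift c t) ≡ 0
occ-shift-cutoff c (var z) with <-≤-connex z c
... | inj₁ z<c rewrite shift-var-below z<c = occ-var-other (>⇒≢ z<c)
... | inj₂ c≤z rewrite shift-var-above c≤z = occ-var-other (<⇒≢ (s≤s c≤z))
occ-shift-cutoff c (lam t) = occ-shift-cutoff (suc c) t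
occ-shift-cutoff c (app t u) = cong₂ _+_ (occ-shift-cutoff c t) (occ-shift-cutoff c u)

occ-shift-above : ∀ y c t → c ≤ y → occ (suc y) (shift c t) ≡ occ y t
occ-shift-above y c (var z) c≤y with <-≤-connex z c
... | inj₁ z<c
  rewrite shift-var-below z<c | occ-var-other {suc y} {z} (>⇒≢ (<-≤-trans z<c (m≤n⇒m≤1+n c≤y)))
        | occ-var-other {y} {z} (>⇒≢ (<-≤-trans z<c c≤y)) = refl
... | inj₂ c≤z rewrite shift-var-above c≤z = refl
occ-shift-above y c (lam t) c≤y = occ-shift-above (suc y) (suc c) t (s≤s c≤y)
occ-shift-above y c (app t u) c≤y = cong₂ _+_ (occ-shift-above y c t c≤y) (occ-shift-above y c u c≤y)

open +-*-Solver using (solve; _:+_; _:*_; _:=_)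

sum-of-linear : ∀ a b c d s → (a + c * s) + (b + d * s) ≡ (a + b) + (c + d) * s
sum-of-linear = solve 5 (λ a b c d s → (a :+ c :* s) :+ (b :+ d :* s) := (a :+ b) :+ (c :+ d) :* s) refl

occ-subst-below : ∀ y x t s → y < x → occ y (subst x t s) ≡ occ y t + occ x t * occ y s
occ-subst-below y x (var z) s y<x with <-cmp z x
... | tri< z<x _ _
  rewrite subst-var-below {s = s} z<x | occ-var-other {x} {z} (>⇒≢ z<x) = sym (+-identityʳ _)
... | tri≈ _ refl _
  rewrite subst-var-here {x} {s} | occ-var-other {y} {x} (<⇒≢ y<x) | occ-var-self x =
    sym (+-identityʳ (occ y s))
occ-subst-below y x (var (suc z)) s y<x | tri> _ _ x<z
  rewrite subst-var-above {s = s} x<z | occ-var-other {x} {suc z} (<⇒≢ x<z)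
        | occ-var-other {y} {z} (<⇒≢ (<-≤-trans y<x (≤-pred x<z)))
        | occ-var-other {y} {suc z} (<⇒≢ (<-trans y<x x<z)) = refl
occ-subst-below y x (lam t) s y<x =
  trans (occ-subst-below (suc y) (suc x) t (shift 0 s) (s≤s y<x))
        (cong (λ n → occ (suc y) t + occ (suc x) t * n) (occ-shift-above y 0 s z≤n))
occ-subst-below y x (app t u) s y<x =
  trans (cong₂ _+_ (occ-subst-below y x t s y<x) (occ-subst-below y x u s y<x))
        (sum-of-linear (occ y t) (occ y u) (occ x t) (occ x u) (occ y s))

occ-subst-above : ∀ y x t s → x ≤ y → occ y (subst x t s) ≡ occ (suc y) t + occ x t * occ y s
occ-subst-above y x (var z) s x≤y with <-cmp z x
... | tri< z<x _ _
  rewrite subst-var-below {s = s} z<x | occ-var-other {x} {z} (>⇒≢ z<x)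
        | occ-var-other {y} {z} (>⇒≢ (<-≤-trans z<x x≤y))
        | occ-var-other {suc y} {z} (>⇒≢ (<-≤-trans z<x (m≤n⇒m≤1+n x≤y))) = refl
... | tri≈ _ refl _
  rewrite subst-var-here {x} {s} | occ-var-self x | occ-var-other {suc y} {x} (>⇒≢ (s≤s x≤y)) =
    sym (+-identityʳ _)
occ-subst-above y x (var (suc z)) s x≤y | tri> _ _ x<z
  rewrite subst-var-above {s = s} x<z | occ-var-other {x} {suc z} (<⇒≢ x<z) = sym (+-identityʳ _)
occ-subst-above y x (lam t) s x≤y =
  trans (occ-subst-above (suc y) (suc x) t (shift 0 s) (s≤s x≤y))
        (cong (λ n → occ (suc (suc y)) t + occ (suc x) t * n) (occ-shift-above y 0 s z≤n))
occ-subst-above y x (app t u) s x≤y =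
  trans (cong₂ _+_ (occ-subst-above y x t s x≤y) (occ-subst-above y x u s x≤y))
        (sum-of-linear (occ (suc y) t) (occ (suc y) u) (occ x t) (occ x u) (occ y s))

-- Parallel reduction restricted by level: Par k t u contracts, in parallel,
-- redexes of t of level ≥ k only (the argument of an application is one
-- level deeper, and a head redex (λt)s has level 0).  Par 0 is ordinary
-- parallel β-reduction.

data Par : ℕ → Term → Term → Set where
  pvar  : ∀ {k x} → Par k (var x) (var x)
  plam  : ∀ {k t t'} → Par k t t' → Par k (lam t) (lam t')
  papp  : ∀ {k t t' s s'} → Par k t t' → Par (pred k) s s' → Par k (app t s) (app t' s')
  pbeta : ∀ {t t' s s' u} → Par 0 t t' → Par 0 s s' → u ≡ t' [ s' ] →
          Par 0 (app (lam t) s) u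

-- An upper bound on the number of β-steps performed when developing a
-- parallel step; a contracted redex duplicates its argument's work once per
-- occurrence of the bound variable.
weight : ∀ {k t u} → Par k t u → ℕ
weight pvar = 0
weight (plam p) = weight p
weight (papp p q) = weight p + weight q
weight (pbeta {t' = t'} p q _) = suc (weight p + occ 0 t' * weight q)

par-refl : ∀ k t → Par k t t
par-refl k (var x) = pvar
par-refl k (lam t) = plam (par-refl k t)
par-refl k (app t s) = papp (par-refl k t) (par-refl (pred k) s)

weight-par-refl : ∀ k t → weight (par-refl k t) ≡ 0
weight-par-refl k (var x) = refl
weight-par-refl k (lam t) = weight-par-refl k t
weight-par-refl k (app t s) = cong₂ _+_ (weight-par-refl k t) (weight-par-refl (pred k) s)

par-weaken : ∀ {j k t u} → j ≤ k → Par k t u → Par j t u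
par-weaken j≤k pvar = pvar
par-weaken j≤k (plam p) = plam (par-weaken j≤k p)
par-weaken j≤k (papp p q) = papp (par-weaken j≤k p) (par-weaken (pred-mono-≤ j≤k) q)
par-weaken z≤n (pbeta p q e) = pbeta p q e

par-shift : ∀ c {s s'} (q : Par 0 s s') →
  Σ (Par 0 (shift c s) (shift c s')) λ r → weight r ≡ weight q
par-shift c (pvar {x = x}) = par-refl 0 (shift c (var x)) , weight-par-refl 0 (shift c (var x))
par-shift c (plam p) = map plam (λ e → e) (par-shift (suc c) p)
par-shift c (papp p q) with par-shift c p | par-shift c q
... | r₁ , e₁ | r₂ , e₂ = papp r₁ r₂ , cong₂ _+_ e₁ e₂
par-shift c (pbeta {t' = t'} {s' = s'} p q refl) with par-shift (suc c) p | par-shift c q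
... | r₁ , e₁ | r₂ , e₂ =
  pbeta r₁ r₂ (shift-subst-above c 0 t' s' z≤n) ,
  cong suc (cong₂ _+_ e₁ (cong₂ _*_ (occ-shift-below 0 (suc c) t' (s≤s z≤n)) e₂))

weight-regroup : ∀ a b o₀ o₁ o₂ m →
  (a + o₁ * m) + o₀ * (b + o₂ * m) ≡ (a + o₀ * b) + (o₁ + o₀ * o₂) * m
weight-regroup = solve 6 (λ a b o₀ o₁ o₂ m →
  (a :+ o₁ :* m) :+ o₀ :* (b :+ o₂ :* m) := (a :+ o₀ :* b) :+ (o₁ :+ o₀ :* o₂) :* m) refl

-- Substitution lemma for parallel reduction, with weight accounting: the
-- argument's parallel step is performed once per occurrence of x in the result.
par-subst : ∀ x {t t' s s'} (p : Par 0 t t') (q : Par 0 s s') →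
  Σ (Par 0 (subst x t s) (subst x t' s')) λ r → weight r ≤ weight p + occ x t' * weight q
par-subst x {s = s} {s' = s'} (pvar {x = z}) q with <-cmp z x
... | tri< z<x _ _ rewrite subst-var-below {s = s} z<x | subst-var-below {s = s'} z<x = pvar , z≤n
... | tri≈ _ refl _ rewrite subst-var-here {x} {s} | subst-var-here {x} {s'} | occ-var-self x =
  q , ≤-reflexive (sym (+-identityʳ _))
par-subst x {s = s} {s' = s'} (pvar {x = suc z}) q | tri> _ _ x<z
  rewrite subst-var-above {s = s} x<z | subst-var-above {s = s'} x<z = pvar , z≤n
par-subst x (plam {t' = t'} p) q with par-shift 0 q
... | q↑ , e with par-subst (suc x) p q↑
... | r , r≤ = plam r , transport (λ w → weight r ≤ weight p + occ (suc x) t' * w) e r≤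
par-subst x (papp {t' = t'} {s' = u'} p₁ p₂) q with par-subst x p₁ q | par-subst x p₂ q
... | r₁ , r₁≤ | r₂ , r₂≤ =
  papp r₁ r₂ ,
  ≤-trans (+-mono-≤ r₁≤ r₂≤)
          (≤-reflexive (sum-of-linear (weight p₁) (weight p₂) (occ x t') (occ x u') (weight q)))
par-subst x {s' = s'} (pbeta {t' = t'} {s' = u'} p₁ p₂ refl) q with par-shift 0 q
... | q↑ , e with par-subst (suc x) p₁ q↑ | par-subst x p₂ q
... | r₁ , r₁≤ | r₂ , r₂≤ = pbeta r₁ r₂ (subst-subst x 0 t' u' s' z≤n) , bound
  where
  open ≤-Reasoning
  o₀ = occ 0 t'
  o₁ = occ (suc x) t'
  o₂ = occ x u'
  occ-bound : occ 0 (subst (suc x) t' (shift 0 s')) ≡ o₀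
  occ-bound = begin-equality
    occ 0 (subst (suc x) t' (shift 0 s'))  ≡⟨ occ-subst-below 0 (suc x) t' (shift 0 s') (s≤s z≤n) ⟩
    o₀ + o₁ * occ 0 (shift 0 s')           ≡⟨ cong (λ w → o₀ + o₁ * w) (occ-shift-cutoff 0 s') ⟩
    o₀ + o₁ * 0                            ≡⟨ cong (o₀ +_) (*-zeroʳ o₁) ⟩
    o₀ + 0                                 ≡⟨ +-identityʳ o₀ ⟩
    o₀                                     ∎
  r₁≤' : weight r₁ ≤ weight p₁ + o₁ * weight q
  r₁≤' = transport (λ w → weight r₁ ≤ weight p₁ + o₁ * w) e r₁≤
  bound : suc (weight r₁ + occ 0 (subst (suc x) t' (shift 0 s')) * weight r₂) ≤
          suc (weight p₁ + o₀ * weight p₂) + occ x (t' [ u' ]) * weight q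
  bound = begin
    suc (weight r₁ + occ 0 (subst (suc x) t' (shift 0 s')) * weight r₂)
      ≡⟨ cong (λ o → suc (weight r₁ + o * weight r₂)) occ-bound ⟩
    suc (weight r₁ + o₀ * weight r₂)
      ≤⟨ s≤s (+-mono-≤ r₁≤' (*-monoʳ-≤ o₀ r₂≤)) ⟩
    suc ((weight p₁ + o₁ * weight q) + o₀ * (weight p₂ + o₂ * weight q))
      ≡⟨ cong suc (weight-regroup (weight p₁) (weight p₂) o₀ o₁ o₂ (weight q)) ⟩
    suc (weight p₁ + o₀ * weight p₂) + (o₁ + o₀ * o₂) * weight q
      ≡⟨ cong (λ o → suc (weight p₁ + o₀ * weight p₂) + o * weight q)
              (sym (occ-subst-above x 0 t' u' z≤n)) ⟩
    suc (weight p₁ + o₀ * weight p₂) + occ x (t' [ u' ]) * weight q ∎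

step⇒par : ∀ {t u k} → t →β[ k ] u → Par k t u
step⇒par beta = pbeta (par-refl 0 _) (par-refl 0 _) refl
step⇒par (ξlam st) = plam (step⇒par st)
step⇒par (ξappl st) = papp (step⇒par st) (par-refl _ _)
step⇒par (ξappr st) = papp (par-refl _ _) (step⇒par st)

_→β[≥_]_ : Term → ℕ → Term → Set
t →β[≥ k ] u = ∃ λ j → k ≤ j × t →β[ j ] u

par⇒steps : ∀ {k t u} → Par k t u → Star (_→β[≥ k ]_) t u
par⇒steps pvar = ε
par⇒steps (plam p) = gmap lam (map₂ (map₂ ξlam)) (par⇒steps p)
par⇒steps (papp {t' = t'} {s = s} p q) =
  gmap (λ a → app a s) (map₂ (map₂ ξappl)) (par⇒steps p) ◅◅
  gmap (app t') (λ { (j , k≤ , st) → suc j , pred-≤-suc k≤ , ξappr st }) (par⇒steps q)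
  where
  pred-≤-suc : ∀ {k j} → pred k ≤ j → k ≤ suc j
  pred-≤-suc {zero} _ = z≤n
  pred-≤-suc {suc k} k≤j = s≤s k≤j
par⇒steps (pbeta {t' = t'} {s = s} p q refl) =
  gmap (λ a → app (lam a) s) (map₂ (map₂ (λ st → ξappl (ξlam st)))) (par⇒steps p) ◅◅
  gmap (app (lam t')) (λ { (j , _ , st) → suc j , z≤n , ξappr st }) (par⇒steps q) ◅◅
  (0 , z≤n , beta) ◅ ε

-- Postponement of non-least-level steps.

deg-stable-above* : ∀ {k t u d} → Star (_→β[≥ k ]_) t u → deg t ≡ fin d → d < k → deg u ≡ fin d
deg-stable-above* ε eq d<k = eq
deg-stable-above* ((j , k≤j , st) ◅ sts) eq d<k =
  deg-stable-above* sts (deg-stable-above st eq (<-≤-trans d<k k≤j)) d<k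

steps-above-deg⇒nll* : ∀ {k t u} → Star (_→β[≥ k ]_) t u → deg t <∞ k → Star _→nll_ t u
steps-above-deg⇒nll* ε _ = ε
steps-above-deg⇒nll* {t = t} ((j , k≤j , st) ◅ sts) deg<k with <∞⇒fin {deg t} deg<k
... | d , eq , d<k =
  (j , transport (_<∞ j) (sym eq) (<-≤-trans d<k k≤j) , st) ◅
  steps-above-deg⇒nll* sts (transport (_<∞ _) (sym (deg-stable-above st eq (<-≤-trans d<k k≤j))) d<k)

deg∞-no-steps : ∀ {k t u} → deg t ≡ ∞ → Star (_→β[≥ k ]_) t u → t ≡ u
deg∞-no-steps eq ε = refl
deg∞-no-steps eq ((j , _ , st) ◅ _) with transport (_≤∞ fin j) eq (deg-≤-level st)
... | ()

-- A parallel step above k followed by a β-step below k is one parallel step: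
-- the later redex was already present, untouched, in the source.
merge : ∀ {k t a b j} → Par k t a → a →β[ j ] b → j < k → Par 0 t b
merge (papp (plam p₁) p₂) beta _ = pbeta (par-weaken z≤n p₁) (par-weaken z≤n p₂) refl
merge (plam p) (ξlam st) j<k = plam (merge p st j<k)
merge (papp p₁ p₂) (ξappl st) j<k = papp (merge p₁ st j<k) (par-weaken z≤n p₂)
merge (papp p₁ p₂) (ξappr st) (s≤s j<k) = papp (par-weaken z≤n p₁) (merge p₂ st j<k)
merge (papp (pbeta _ _ _) _) beta ()
merge (pbeta _ _ _) _ ()

split-step : ∀ j {t b} (p : Par 0 t b) → fin j ≤∞ deg t →
  Par (suc j) t b ⊎ (∃ λ t₁ → t →β[ j ] t₁ × Σ (Par 0 t₁ b) λ p₁ → weight p₁ < weight p)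
split-step j pvar _ = inj₁ pvar
split-step j (plam p) lb with split-step j p lb
... | inj₁ q = inj₁ (plam q)
... | inj₂ (t₁ , st , p₁ , lt) = inj₂ (lam t₁ , ξlam st , plam p₁ , lt)
split-step zero (pbeta {t = t} {s = s} p₁ p₂ refl) _ with par-subst 0 p₁ p₂
... | r , r≤ = inj₂ (t [ s ] , beta , r , s≤s r≤)
split-step (suc j) (pbeta _ _ _) (fin≤fin ())
split-step (suc j) (papp {t = lam _} p₁ p₂) (fin≤fin ())
split-step zero (papp {t = lam _} {s = s} p₁ p₂) _ with split-step zero p₁ (0≤∞ _)
... | inj₁ q = inj₁ (papp q p₂)
... | inj₂ (t₁ , st , p₁' , lt) = inj₂ (app t₁ s , ξappl st , papp p₁' p₂ , +-monoˡ-< (weight p₂) lt)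
split-step zero (papp {t = var x} pvar p₂) _ = inj₁ (papp pvar p₂)
split-step (suc j) (papp {t = var x} pvar p₂) lb with split-step j p₂ (suc∞-cancel-fin≤ lb)
... | inj₁ q = inj₁ (papp pvar q)
... | inj₂ (s₁ , st , p₂' , lt) = inj₂ (app (var x) s₁ , ξappr st , papp pvar p₂' , lt)
split-step j (papp {t = app a b} {s = s} p₁ p₂) lb
  with split-step j p₁ (≤min∞⇒≤ˡ {b = suc∞ (deg s)} lb)
... | inj₂ (t₁ , st , p₁' , lt) = inj₂ (app t₁ s , ξappl st , papp p₁' p₂ , +-monoˡ-< (weight p₂) lt)
split-step zero (papp {t = app a b} p₁ p₂) lb | inj₁ q₁ = inj₁ (papp q₁ p₂)
split-step (suc j) (papp {t = app a b} p₁ p₂) lb | inj₁ q₁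
  with split-step j p₂ (suc∞-cancel-fin≤ (≤min∞⇒≤ʳ {a = deg (app a b)} lb))
... | inj₁ q₂ = inj₁ (papp q₁ q₂)
... | inj₂ (s₁ , st , p₂' , lt) =
  inj₂ (app (app a b) s₁ , ξappr st , papp p₁ p₂' , +-monoʳ-< (weight p₁) lt)

-- Parallel reduction strictly above the least level (or the identity on a
-- term without redexes): it stands for a ¬ℓℓ-reduction sequence.
_⇉nll_ : Term → Term → Set
t ⇉nll b = (∃ λ k → deg t <∞ k × Par k t b) ⊎ (deg t ≡ ∞ × t ≡ b)

⇉nll⇒nll* : ∀ {t b} → t ⇉nll b → Star _→nll_ t b
⇉nll⇒nll* (inj₁ (k , deg<k , p)) = steps-above-deg⇒nll* (par⇒steps p) deg<k
⇉nll⇒nll* (inj₂ (_ , refl)) = ε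

-- Every parallel step factors as ℓℓ-steps followed by a ⇉nll-step, by
-- induction on a bound n for the weight, which drops at each ℓℓ-step that
-- split-step peels off.
split : ∀ n {t b} (p : Par 0 t b) → weight p < n → ∃ λ c → Star _→ll_ t c × c ⇉nll b
split zero p ()
split (suc n) {t} p _ with deg t in eq
... | ∞ = t , ε , inj₂ (eq , deg∞-no-steps eq (par⇒steps p))
split (suc n) {t} p w<n | fin d with split-step d p (≡⇒fin≤ eq)
... | inj₁ q = t , ε , inj₁ (suc d , transport (_<∞ suc d) (sym eq) (n<1+n d) , q)
... | inj₂ (t₁ , st , p₁ , w₁<w) with split n p₁ (<-≤-trans w₁<w (≤-pred w<n))
...   | c , lls , c⇉b = c , (d , eq , st) ◅ lls , c⇉b

-- An ℓℓ-step after a ⇉nll-step can be moved in front of it (the ⇉nll-step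
-- does not change the least level, so the ℓℓ-redex was already there).
⇉nll-ll-swap : ∀ {t a b} → t ⇉nll a → a →ll b → ∃ λ c → Star _→ll_ t c × c ⇉nll b
⇉nll-ll-swap (inj₂ (deg∞ , refl)) (k , degk , _) with trans (sym deg∞) degk
... | ()
⇉nll-ll-swap {t} (inj₁ (k , deg<k , p)) (j , degj , st) with <∞⇒fin {deg t} deg<k
... | d , eq , d<k with trans (sym degj) (deg-stable-above* (par⇒steps p) eq d<k)
... | refl = split _ (merge p st d<k) (n<1+n _)

⇉nll-ll*-swap : ∀ {t a b} → t ⇉nll a → Star _→ll_ a b → ∃ λ c → Star _→ll_ t c × c ⇉nll b
⇉nll-ll*-swap t⇉a ε = _ , ε , t⇉a
⇉nll-ll*-swap t⇉a (st ◅ sts) with ⇉nll-ll-swap t⇉a st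
... | c , lls , c⇉ with ⇉nll-ll*-swap c⇉ sts
... | c' , lls' , c'⇉ = c' , lls ◅◅ lls' , c'⇉

ll-or-nll : ∀ {t u k} → t →β[ k ] u → t →ll u ⊎ t →nll u
ll-or-nll {t} {k = k} st with deg t in eq | deg-≤-level st
... | fin d | fin≤fin d≤k with m≤n⇒m<n∨m≡n d≤k
...   | inj₁ d<k = inj₂ (k , d<k , st)
...   | inj₂ refl = inj₁ (k , refl , st)

factorization : ∀ {t u} → Star _→β_ t u → ∃ λ s → Star _→ll_ t s × Star _→nll_ s u
factorization ε = _ , ε , ε
factorization ((k , st) ◅ sts) with factorization sts | ll-or-nll st
... | s , lls , nlls | inj₁ ll = s , ll ◅ lls , nlls
... | s , lls , nlls | inj₂ (k' , deg<k' , st') with ⇉nll-ll*-swap (inj₁ (k' , deg<k' , step⇒par st')) lls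
...   | c , lls' , c⇉s = c , lls' , ⇉nll⇒nll* c⇉s ◅◅ nlls

β-normal⇒deg∞ : ∀ {t} → Normal _→β_ t → deg t ≡ ∞
β-normal⇒deg∞ {t} nf with deg t in eq
... | ∞ = refl
... | fin d = ⊥-elim (nf _ (d , proj₂ (redex-at-deg t d eq)))

-- any step forces a finite least level, and there sits an ℓℓ-redex
ll-normal⇒β-normal : ∀ {t} → Normal _→ll_ t → Normal _→β_ t
ll-normal⇒β-normal {t} nf u (k , st) with deg t in eq | deg-≤-level st
... | fin d | _ with redex-at-deg t d eq
...   | u' , st' = nf u' (d , refl , st')

β-normal⇒ll-normal : ∀ {t} → Normal _→β_ t → Normal _→ll_ t
β-normal⇒ll-normal nf u (k , _ , st) = nf u (k , st)

-- ¬ℓℓ-steps preserve the least level, so they cannot reach a normal form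
nll*-preserves-deg : ∀ {s n} → Star _→nll_ s n → deg s ≡ deg n
nll*-preserves-deg ε = refl
nll*-preserves-deg {s} ((k , deg<k , st) ◅ sts) with <∞⇒fin {deg s} deg<k
... | d , eq , d<k = trans eq (trans (sym (deg-stable-above st eq d<k)) (nll*-preserves-deg sts))

nll*-into-normal : ∀ {s n} → Star _→nll_ s n → Normal _→β_ n → s ≡ n
nll*-into-normal ε _ = refl
nll*-into-normal sts@((k , deg<k , _) ◅ _) nf =
  ⊥-elim (transport (_<∞ k) (trans (nll*-preserves-deg sts) (β-normal⇒deg∞ nf)) deg<k)

-- The diamond property of least-level reduction.

step-subst : ∀ x {t t' k} s → t →β[ k ] t' → subst x t s →β[ k ] subst x t' s
step-subst x s (beta {t} {u}) =
  transport (app (subst x (lam t) s) (subst x u s) →β[ 0 ]_)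
            (sym (subst-subst x 0 t u s z≤n)) beta
step-subst x s (ξlam st) = ξlam (step-subst (suc x) (shift 0 s) st)
step-subst x s (ξappl st) = ξappl (step-subst x s st)
step-subst x s (ξappr st) = ξappr (step-subst x s st)

level-diamond : ∀ {t u₁ u₂ k} → t →β[ k ] u₁ → t →β[ k ] u₂ →
  u₁ ≡ u₂ ⊎ ∃ λ v → u₁ →β[ k ] v × u₂ →β[ k ] v
level-diamond beta beta = inj₁ refl
level-diamond (beta {s = s}) (ξappl (ξlam st)) = inj₂ (_ , step-subst 0 s st , beta)
level-diamond (ξappl (ξlam st)) (beta {s = s}) = inj₂ (_ , beta , step-subst 0 s st)
level-diamond (ξlam st₁) (ξlam st₂) with level-diamond st₁ st₂
... | inj₁ refl = inj₁ refl
... | inj₂ (v , a , b) = inj₂ (lam v , ξlam a , ξlam b)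
level-diamond (ξappl st₁) (ξappl st₂) with level-diamond st₁ st₂
... | inj₁ refl = inj₁ refl
... | inj₂ (v , a , b) = inj₂ (app v _ , ξappl a , ξappl b)
level-diamond (ξappl st₁) (ξappr st₂) = inj₂ (_ , ξappr st₂ , ξappl st₁)
level-diamond (ξappr st₁) (ξappl st₂) = inj₂ (_ , ξappl st₂ , ξappr st₁)
level-diamond (ξappr st₁) (ξappr st₂) with level-diamond st₁ st₂
... | inj₁ refl = inj₁ refl
... | inj₂ (v , a , b) = inj₂ (app _ v , ξappr a , ξappr b)

-- after an ℓℓ-step of level k no redex below k appears, so a further step
-- of level k is again least-level
ll-then-same-level : ∀ {t u v k} → deg t ≡ fin k → t →β[ k ] u → u →β[ k ] v → u →ll v
ll-then-same-level {k = k} eq st st' =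
  k , ≤∞-antisym (deg-lower-bound-stable k st ≤-refl (≡⇒fin≤ eq)) (deg-≤-level st') , st'

ll-diamond : ∀ {t u₁ u₂} → t →ll u₁ → t →ll u₂ → u₁ ≡ u₂ ⊎ ∃ λ v → u₁ →ll v × u₂ →ll v
ll-diamond (k , eq₁ , st₁) (k' , eq₂ , st₂) with trans (sym eq₁) eq₂
... | refl with level-diamond st₁ st₂
...   | inj₁ u₁≡u₂ = inj₁ u₁≡u₂
...   | inj₂ (v , a , b) = inj₂ (v , ll-then-same-level eq₁ st₁ a , ll-then-same-level eq₁ st₂ b)

-- Random descent: for a relation with the (reflexive) diamond property, every
-- reduction path from t has the same length as any path from t to a normal
-- form, so reaching a normal form implies strong normalization.
module RandomDescent {A : Set} (_⟶_ : A → A → Set)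
  (diamond : ∀ {t u₁ u₂} → t ⟶ u₁ → t ⟶ u₂ → u₁ ≡ u₂ ⊎ ∃ λ v → u₁ ⟶ v × u₂ ⟶ v) where

  Path : ℕ → A → A → Set
  Path zero t n = t ≡ n
  Path (suc m) t n = ∃ λ t₁ → t ⟶ t₁ × Path m t₁ n

  star⇒path : ∀ {t n} → Star _⟶_ t n → ∃ λ m → Path m t n
  star⇒path ε = zero , refl
  star⇒path (st ◅ sts) = map suc (λ path → _ , st , path) (star⇒path sts)

  descend : ∀ m {t n u} → (∀ v → ¬ n ⟶ v) → Path (suc m) t n → t ⟶ u → Path m u n
  descend zero nf (t₁ , st₁ , refl) st with diamond st₁ st
  ... | inj₁ refl = refl
  ... | inj₂ (v , a , _) = ⊥-elim (nf v a)
  descend (suc m) nf (t₁ , st₁ , path) st with diamond st₁ st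
  ... | inj₁ refl = path
  ... | inj₂ (v , a , b) = v , b , descend m nf path a

  path⇒acc : ∀ m {t n} → (∀ v → ¬ n ⟶ v) → Path m t n → Acc (λ u v → v ⟶ u) t
  path⇒acc zero nf refl = acc λ st → ⊥-elim (nf _ st)
  path⇒acc (suc m) nf path = acc λ st → path⇒acc m nf (descend m nf path st)

  normalizing⇒accessible : ∀ {t n} → Star _⟶_ t n → (∀ v → ¬ n ⟶ v) → Acc (λ u v → v ⟶ u) t
  normalizing⇒accessible sts nf with star⇒path sts
  ... | m , path = path⇒acc m nf path

open RandomDescent _→ll_ ll-diamond using (normalizing⇒accessible)

-- Part (2c): a β-normal form n of t is reached by ℓℓ-steps alone (the
-- ¬ℓℓ-part of the factorization is empty), and →ℓℓ descends randomly.
WN-β⇒SN-ll : ∀ t → WeaklyNormalizing _→β_ t → StronglyNormalizing _→ll_ t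
WN-β⇒SN-ll t (n , sts , nf) with factorization sts
... | s , lls , nlls with nll*-into-normal nlls nf
... | refl = normalizing⇒accessible lls (β-normal⇒ll-normal nf)

theorem8 : (∀ t u → (_→β_ *) t u → ∃ λ s → (_→ll_ *) t s × (_→nll_ *) s u)
    × ((∀ t u → t →ll u → t →β u)
    × (∀ t → Normal _→ll_ t ⇔ Normal _→β_ t)
    × (∀ t → WeaklyNormalizing _→β_ t → StronglyNormalizing _→ll_ t))
theorem8 =
  (λ _ _ → factorization) ,
  (λ { _ _ (k , _ , st) → k , st }) ,
  (λ _ → mk⇔ ll-normal⇒β-normal β-normal⇒ll-normal) ,
  WN-β⇒SN-ll
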